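{- Let $A$ be an additive basis and let $X$ be a finite nonempty subset of $A$ such that $A \setminus X$ is still an additive basis, and suppose moreover that $X$ is an arithmetic progression. Let $h := \mathrm{G}(A)$. Then $$\mathrm{G}(A \setminus X) \leq \frac{h (h + 3)}{2} + (|X| - 1)\, \frac{h (h - 1) (h + 4)}{6}.$$
   Context: An additive basis is a set $A \subseteq \mathbb{Z}$ such that $A \cap \mathbb{Z}_{<0}$ is finite and there exists a natural number $h$ such that every sufficiently large positive integer can be written as a sum of exactly $h$ (not necessarily distinct) elements of $A$. The smallest such $h$ is the order of $A$, denoted $\mathrm{G}(A)$. $|X|$ denotes the cardinality of $X$. -}

module Defs where

open import Data.Nat as ℕ using (ℕ)
open import Data.Integer as ℤ using (ℤ; +_)
open import Data.Vec using (Vec)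
open import Data.Vec.Relation.Unary.All using (All)
import Data.Vec as Vec
open import Data.List using (List)
open import Data.List.Membership.Propositional using (_∈_)
open import Data.Product using (Σ; ∃; _×_)
open import Relation.Binary.PropositionalEquality using (_≡_)
open import Relation.Nullary using (¬_)

Subset : Set₁
Subset = ℤ → Set

sumℤ : ∀ {n} → Vec ℤ n → ℤ
sumℤ = Vec.foldr _ ℤ._+_ (+ 0)

FinitelyManyNegatives : Subset → Set
FinitelyManyNegatives A = Σ (List ℤ) λ L → ∀ a → A a → a ℤ.< + 0 → a ∈ L

SumOf : Subset → ℕ → ℤ → Set
SumOf A h n = Σ (Vec ℤ h) λ v → All A v × sumℤ v ≡ n

IsBasisWith : Subset → ℕ → Set
IsBasisWith A h =
  FinitelyManyNegatives A × (∃ λ N → ∀ (n : ℕ) → N ℕ.≤ n → SumOf A h (+ n))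

IsOrder : Subset → ℕ → Set
IsOrder A h = IsBasisWith A h × (∀ k → IsBasisWith A k → h ℕ.≤ k)

AP : ℤ → ℤ → ℕ → Subset
AP a d k z = ∃ λ i → i ℕ.< k × z ≡ a ℤ.+ (+ i) ℤ.* d

_∖_ : Subset → Subset → Subset
(A ∖ X) z = A z × ¬ X z

module Submission where

-- Sort the h summands of a representation of n by A into the i that lie in
-- X = {a + t d : t < k} and the h − i that lie in B = A ∖ X; the former add up to
-- i a + u d with u ≤ i (k − 1), and (i, u) is the type of the representation.  Large n
-- only have types with i < h.  We grow a set R of handled types together with an integer s
-- and a length L such that i a + u d + s is a sum of L + i elements of B for every handled
-- (i, u); then every large n for which n − s has a handled type is a sum of h + L elements
-- of B.  Start from R = {(0, 0)}, s = 0, L = 0.  If some large p has an unhandled type, walk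
-- from p by steps z ↦ z + c − d (c, d ∈ B) to a sum of h elements of B, which has type
-- (0, 0); some step z ↦ z + c − d leaves an unhandled type (i, u) for a handled one, and
-- adding c and the B-part of z to s handles (i, u) at the cost of h − i + 1 new summands.
-- Each type 1 ≤ i < h, u ≤ i (k − 1) is handled at most once, so the order of B is at most
-- h + Σ_{1 ≤ i < h} (i (k − 1) + 1)(h − i + 1), which is the stated bound.  Whether a step
-- of this kind exists is undecidable, so the process runs under double negation, which the
-- decidable conclusion absorbs.

open import Data.Bool using (Bool; true; false; _∧_; _∨_; if_then_else_)
open import Data.Bool.Properties using (T-≡; ∨-zeroʳ)
open import Data.Empty using (⊥-elim)
open import Data.Integer as ℤ using (ℤ; +_; -[1+_])
import Data.Integer.Properties as ℤP
open import Data.Integer.Tactic.RingSolver using (solve-∀)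
open import Data.List as List using (List)
open import Data.List.Membership.Propositional using (_∈_)
open import Data.List.Relation.Unary.Any using (here; there)
open import Data.Nat as ℕ using (ℕ; zero; suc; _+_; _*_; _∸_; _≤_; _<_; z≤n; s≤s)
open import Data.Nat.Induction using (<-wellFounded)
open import Data.Nat.ListAction using (sum)
import Data.Nat.Properties as ℕP
open import Data.Nat.Tactic.RingSolver renaming (solve-∀ to ℕ-solve-∀)
open import Data.Product using (Σ; ∃; _×_; _,_; proj₁; proj₂)
open import Data.Sum using (_⊎_; inj₁; inj₂; [_,_]′)
open import Data.Vec using (Vec; []; _∷_; _++_; replicate)
open import Data.Vec.Relation.Unary.All as All using (All; []; _∷_)
import Data.Vec.Relation.Unary.All.Properties as All
open import Function using (id)
open import Function.Bundles using (Equivalence)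
open import Induction.WellFounded using (Acc; acc)
open import Relation.Binary.PropositionalEquality
open import Relation.Nullary using (¬_; Dec; yes; no)
open import Relation.Nullary.Decidable using (¬¬-excluded-middle; decidable-stable)
open import Relation.Nullary.Negation using (¬¬-map)

open import Defs

sumℤ-++ : ∀ {m n} (xs : Vec ℤ m) (ys : Vec ℤ n) → sumℤ (xs ++ ys) ≡ sumℤ xs ℤ.+ sumℤ ys
sumℤ-++ []       ys = sym (ℤP.+-identityˡ (sumℤ ys))
sumℤ-++ (x ∷ xs) ys = trans (cong (ℤ._+_ x) (sumℤ-++ xs ys)) (sym (ℤP.+-assoc x (sumℤ xs) (sumℤ ys)))

SumOf-+ : ∀ {S m n x y} → SumOf S m x → SumOf S n y → SumOf S (m + n) (x ℤ.+ y)
SumOf-+ (v , Sv , refl) (w , Sw , refl) = v ++ w , All.++⁺ Sv Sw , sumℤ-++ v w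

SumOf-singleton : ∀ {S x} → S x → SumOf S 1 x
SumOf-singleton {x = x} Sx = x ∷ [] , Sx ∷ [] , ℤP.+-identityʳ x

SumOf-zero : ∀ {S x} → SumOf S 0 x → x ≡ + 0
SumOf-zero ([] , [] , eq) = sym eq

sumℤ-lower : ∀ {n} ℓ (v : Vec ℤ n) → All (ℓ ℤ.≤_) v → + n ℤ.* ℓ ℤ.≤ sumℤ v
sumℤ-lower ℓ []            []          = ℤP.≤-refl
sumℤ-lower ℓ (_∷_ {n} x v) (ℓ≤x ∷ ℓ≤v) = begin
  + suc n ℤ.* ℓ       ≡⟨ ℤP.suc-* (+ n) ℓ ⟩
  ℓ ℤ.+ + n ℤ.* ℓ     ≤⟨ ℤP.+-mono-≤ ℓ≤x (sumℤ-lower ℓ v ℓ≤v) ⟩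
  x ℤ.+ sumℤ v        ∎
  where open ℤP.≤-Reasoning

All-replicate : ∀ {P : Subset} n {x} → P x → All P (replicate n x)
All-replicate zero    Px = []
All-replicate (suc n) Px = Px ∷ All-replicate n Px

sumℤ-replicate-≥ : ∀ n {x} → 1 ≤ n → + 0 ℤ.≤ x → x ℤ.≤ sumℤ (replicate n x)
sumℤ-replicate-≥ (suc n) {x} _ 0≤x = begin
  x                                ≡⟨ ℤP.+-identityʳ x ⟨
  x ℤ.+ + 0                        ≡⟨ cong (ℤ._+_ x) (ℤP.*-zeroʳ (+ n)) ⟨
  x ℤ.+ + n ℤ.* + 0                ≤⟨ ℤP.+-monoʳ-≤ x (sumℤ-lower (+ 0) (replicate n x) (All-replicate n 0≤x)) ⟩
  x ℤ.+ sumℤ (replicate n x)       ∎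
  where open ℤP.≤-Reasoning

element-above : ∀ {S : Subset} {n} M (v : Vec ℤ n) → All S v → + n ℤ.* M ℤ.< sumℤ v → ∃ λ x → S x × M ℤ.< x
element-above M []            []        0<0 = ⊥-elim (ℤP.<-irrefl refl 0<0)
element-above M (_∷_ {n} x v) (Sx ∷ Sv) nM<sum with M ℤP.<? x
... | yes M<x = x , Sx , M<x
... | no  M≮x = element-above M v Sv (ℤP.≰⇒> λ v≤nM → ℤP.<⇒≱ nM<sum (sum≤ v≤nM))
  where
  open ℤP.≤-Reasoning
  sum≤ : sumℤ v ℤ.≤ + n ℤ.* M → x ℤ.+ sumℤ v ℤ.≤ + suc n ℤ.* M
  sum≤ v≤nM = begin
    x ℤ.+ sumℤ v      ≤⟨ ℤP.+-mono-≤ (ℤP.≮⇒≥ M≮x) v≤nM ⟩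
    M ℤ.+ + n ℤ.* M   ≡⟨ ℤP.suc-* (+ n) M ⟨
    + suc n ℤ.* M     ∎

SumOf-element-above : ∀ {S : Subset} {n z} M → SumOf S n z → + n ℤ.* M ℤ.< z → ∃ λ x → S x × M ℤ.< x
SumOf-element-above M (v , Sv , refl) = element-above M v Sv

negatives-bounded : ∀ {A} → FinitelyManyNegatives A → ∃ λ μ → ∀ {x} → A x → ℤ.- + μ ℤ.≤ x
negatives-bounded {A} (L , negatives∈L) = μ , μ-bound
  where
  μ : ℕ
  μ = sum (List.map ℤ.∣_∣ L)

  ∣∣≤μ : ∀ {x} {xs : List ℤ} → x ∈ xs → ℤ.∣ x ∣ ≤ sum (List.map ℤ.∣_∣ xs)
  ∣∣≤μ {x} {_ List.∷ xs} (here refl) = ℕP.m≤m+n ℤ.∣ x ∣ _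
  ∣∣≤μ {_} {y List.∷ _}  (there x∈) = ℕP.m≤n⇒m≤o+n ℤ.∣ y ∣ (∣∣≤μ x∈)

  μ-bound : ∀ {x} → A x → ℤ.- + μ ℤ.≤ x
  μ-bound {+ n}      _  = ℤP.neg-≤-pos
  μ-bound { -[1+ n ]} Ax = ℤP.neg-mono-≤ (ℤ.+≤+ (∣∣≤μ (negatives∈L _ Ax ℤ.-<+)))

IsBasisWith⇒1≤ : ∀ {A h} → IsBasisWith A h → 1 ≤ h
IsBasisWith⇒1≤ {h = zero} (_ , N , rep) with rep (suc N) (ℕP.n≤1+n N)
... | [] , [] , ()
IsBasisWith⇒1≤ {h = suc h} _ = s≤s z≤n

IsBasisWith⇒unbounded : ∀ {S n} → IsBasisWith S n → ∀ p → ∃ λ x → S x × + p ℤ.< x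
IsBasisWith⇒unbounded {n = n} (_ , N , rep) p =
  SumOf-element-above (+ p) (rep (n * p + suc N) (ℕP.≤-trans (ℕP.n≤1+n N) (ℕP.m≤n+m (suc N) (n * p))))
    (subst (ℤ._< + (n * p + suc N)) (ℤP.pos-* n p) (ℤ.+<+ (ℕP.m<m+n (n * p) (s≤s z≤n))))

Crossing : (S Out In : Subset) → Set
Crossing S Out In = ∃ λ z → ∃ λ c → ∃ λ d → S c × S d × Out z × In (z ℤ.+ c ℤ.- d)

module _ {S Out In : Subset} (ℓ : ℤ) (S≥ℓ : ∀ {x} → S x → ℓ ℤ.≤ x)
         (N : ℤ) (Out⊎In : ∀ z → N ℤ.≤ z → Out z ⊎ In z) where

  -- The bound keeps every intermediate point of the walk above N, as elements of S are ≥ ℓ.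
  walk-crosses : ∀ {t} → 1 ≤ t → (C D : Vec ℤ t) → All S C → All S D →
                 ∀ z → N ℤ.- + t ℤ.* ℓ ℤ.≤ z ℤ.- sumℤ D →
                 Out z → In (z ℤ.+ sumℤ C ℤ.- sumℤ D) → Crossing S Out In
  walk-crosses {1} _ (c ∷ []) (d ∷ []) (Sc ∷ []) (Sd ∷ []) z _ out in-end =
    z , c , d , Sc , Sd , out , subst In (last-step z c d) in-end
    where
    last-step : ∀ z c d → z ℤ.+ (c ℤ.+ + 0) ℤ.- (d ℤ.+ + 0) ≡ z ℤ.+ c ℤ.- d
    last-step = solve-∀
  walk-crosses {suc (suc t)} _ (c ∷ C) (d ∷ D) (Sc ∷ SC) (Sd ∷ SD) z bound out in-end =
    [ (λ out′ → walk-crosses (s≤s z≤n) C D SC SD z′ bound′ out′ (subst In (regroup z c d _ _) in-end))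
    , (λ in′ → z , c , d , Sc , Sd , out , in′)
    ]′ (Out⊎In z′ z′≥N)
    where
    open ℤP.≤-Reasoning
    z′ : ℤ
    z′ = z ℤ.+ c ℤ.- d

    regroup : ∀ z c d σ τ → z ℤ.+ (c ℤ.+ σ) ℤ.- (d ℤ.+ τ) ≡ z ℤ.+ c ℤ.- d ℤ.+ σ ℤ.- τ
    regroup = solve-∀
    peel : ∀ N T ℓ → N ℤ.- T ℤ.* ℓ ≡ N ℤ.- (+ 1 ℤ.+ T) ℤ.* ℓ ℤ.+ ℓ
    peel = solve-∀
    shift : ∀ z c d τ → z ℤ.- (d ℤ.+ τ) ℤ.+ c ≡ z ℤ.+ c ℤ.- d ℤ.- τ
    shift = solve-∀
    cancel : ∀ x y → x ≡ x ℤ.- y ℤ.+ y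
    cancel = solve-∀

    bound′ : N ℤ.- + suc t ℤ.* ℓ ℤ.≤ z′ ℤ.- sumℤ D
    bound′ = begin
      N ℤ.- + suc t ℤ.* ℓ                    ≡⟨ peel N (+ suc t) ℓ ⟩
      N ℤ.- + suc (suc t) ℤ.* ℓ ℤ.+ ℓ        ≤⟨ ℤP.+-mono-≤ bound (S≥ℓ Sc) ⟩
      z ℤ.- (d ℤ.+ sumℤ D) ℤ.+ c             ≡⟨ shift z c d (sumℤ D) ⟩
      z′ ℤ.- sumℤ D                          ∎

    z′≥N : N ℤ.≤ z′
    z′≥N = begin
      N                                        ≡⟨ cancel N (+ suc t ℤ.* ℓ) ⟩
      N ℤ.- + suc t ℤ.* ℓ ℤ.+ + suc t ℤ.* ℓ  ≤⟨ ℤP.+-mono-≤ bound′ (sumℤ-lower ℓ D (All.map S≥ℓ SD)) ⟩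
      z′ ℤ.- sumℤ D ℤ.+ sumℤ D               ≡⟨ sym (cancel z′ (sumℤ D)) ⟩
      z′                                       ∎

sumTo : (ℕ → ℕ) → ℕ → ℕ
sumTo f zero    = 0
sumTo f (suc n) = sumTo f n + f n

sumTo-mono-≤ : ∀ {f g} → (∀ i → f i ≤ g i) → ∀ n → sumTo f n ≤ sumTo g n
sumTo-mono-≤ f≤g zero    = z≤n
sumTo-mono-≤ f≤g (suc n) = ℕP.+-mono-≤ (sumTo-mono-≤ f≤g n) (f≤g n)

sumTo-cong : ∀ {f g} → (∀ i → f i ≡ g i) → ∀ n → sumTo f n ≡ sumTo g n
sumTo-cong f≡g zero    = refl
sumTo-cong f≡g (suc n) = cong₂ _+_ (sumTo-cong f≡g n) (f≡g n)

sumTo-const : ∀ c n → sumTo (λ _ → c) n ≡ n * c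
sumTo-const c zero    = refl
sumTo-const c (suc n) = trans (cong (_+ c) (sumTo-const c n)) (ℕP.+-comm (n * c) c)

sumTo-gap : ∀ {f g c j} → (∀ i → f i ≤ g i) → f j + c ≤ g j →
            ∀ n → j < n → sumTo f n + c ≤ sumTo g n
sumTo-gap {f} {g} {c} {j} f≤g gap (suc n) (s≤s j≤n) with ℕP.m≤n⇒m<n∨m≡n j≤n
... | inj₁ j<n = begin
  sumTo f n + f n + c   ≡⟨ swap-last (sumTo f n) (f n) c ⟩
  sumTo f n + c + f n   ≤⟨ ℕP.+-mono-≤ (sumTo-gap f≤g gap n j<n) (f≤g n) ⟩
  sumTo g n + g n       ∎
  where
  open ℕP.≤-Reasoning
  swap-last : ∀ x y z → x + y + z ≡ x + z + y
  swap-last = ℕ-solve-∀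
... | inj₂ refl = begin
  sumTo f n + f n + c   ≡⟨ ℕP.+-assoc (sumTo f n) (f n) c ⟩
  sumTo f n + (f n + c) ≤⟨ ℕP.+-mono-≤ (sumTo-mono-≤ f≤g n) gap ⟩
  sumTo g n + g n       ∎
  where open ℕP.≤-Reasoning

sumTo-weights-suc : ∀ f H n → n ≤ suc H →
  sumTo (λ i → f i * suc (suc H ∸ i)) n ≡ sumTo (λ i → f i * suc (H ∸ i)) n + sumTo f n
sumTo-weights-suc f H zero    _         = refl
sumTo-weights-suc f H (suc n) (s≤s n≤H) = begin
  sumTo (λ i → f i * suc (suc H ∸ i)) n + f n * suc (suc H ∸ n)
    ≡⟨ cong₂ _+_ (sumTo-weights-suc f H n (ℕP.m≤n⇒m≤1+n n≤H)) (cong (λ x → f n * suc x) (ℕP.+-∸-assoc 1 n≤H)) ⟩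
  sumTo (λ i → f i * suc (H ∸ i)) n + sumTo f n + f n * suc (suc (H ∸ n))
    ≡⟨ regroup (sumTo (λ i → f i * suc (H ∸ i)) n) (sumTo f n) (f n) (H ∸ n) ⟩
  sumTo (λ i → f i * suc (H ∸ i)) n + f n * suc (H ∸ n) + (sumTo f n + f n) ∎
  where
  open ≡-Reasoning
  regroup : ∀ a b c e → a + b + c * suc (suc e) ≡ a + c * suc e + (b + c)
  regroup = ℕ-solve-∀

module _ (m : ℕ) where
  private
    w : ℕ → ℕ
    w i = suc (suc i * m)

    triangle : ℕ → ℕ
    triangle n = sumTo (λ i → w i * suc (n ∸ i)) n

    twice-sumTo-w : ∀ n → 2 * sumTo w n ≡ 2 * n + m * (n * suc n)
    twice-sumTo-w zero    = sym (ℕP.*-zeroʳ m)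
    twice-sumTo-w (suc n) = begin
      2 * (sumTo w n + w n)                          ≡⟨ ℕP.*-distribˡ-+ 2 (sumTo w n) (w n) ⟩
      2 * sumTo w n + 2 * w n                        ≡⟨ cong (_+ 2 * w n) (twice-sumTo-w n) ⟩
      2 * n + m * (n * suc n) + 2 * suc (suc n * m)  ≡⟨ step n m ⟩
      2 * suc n + m * (suc n * suc (suc n))          ∎
      where
      open ≡-Reasoning
      step : ∀ n m → 2 * n + m * (n * suc n) + 2 * suc (suc n * m) ≡ 2 * suc n + m * (suc n * suc (suc n))
      step = ℕ-solve-∀

    triangle-suc : ∀ n → triangle (suc n) ≡ triangle n + sumTo w n + w n * 2
    triangle-suc n = cong₂ _+_ (sumTo-weights-suc w n n (ℕP.n≤1+n n)) (cong (λ x → w n * suc x) (ℕP.m+n∸n≡m 1 n))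

  triangle-closed-form : ∀ n →
    6 * (suc n + sumTo (λ i → suc (suc i * m) * suc (n ∸ i)) n) + 6 ≡
    3 * (suc n * (suc n + 3)) + m * (suc n * n * (suc n + 4))
  triangle-closed-form zero    = cong (_+_ 12) (sym (ℕP.*-zeroʳ m))
  triangle-closed-form (suc n) = begin
    6 * (suc (suc n) + triangle (suc n)) + 6
      ≡⟨ cong (λ x → 6 * (suc (suc n) + x) + 6) (triangle-suc n) ⟩
    6 * (suc (suc n) + (triangle n + sumTo w n + w n * 2)) + 6
      ≡⟨ regroup n (triangle n) (sumTo w n) m ⟩
    (6 * (suc n + triangle n) + 6) + 3 * (2 * sumTo w n) + 6 + 12 * w n
      ≡⟨ cong₂ (λ x y → x + 3 * y + 6 + 12 * w n) (triangle-closed-form n) (twice-sumTo-w n) ⟩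
    3 * (suc n * (suc n + 3)) + m * (suc n * n * (suc n + 4)) + 3 * (2 * n + m * (n * suc n)) + 6 + 12 * w n
      ≡⟨ expand n m ⟩
    3 * (suc (suc n) * (suc (suc n) + 3)) + m * (suc (suc n) * suc n * (suc (suc n) + 4)) ∎
    where
    open ≡-Reasoning
    regroup : ∀ n t s m → 6 * (suc (suc n) + (t + s + suc (suc n * m) * 2)) + 6 ≡
                          (6 * (suc n + t) + 6) + 3 * (2 * s) + 6 + 12 * suc (suc n * m)
    regroup = ℕ-solve-∀
    expand : ∀ n m → 3 * (suc n * (suc n + 3)) + m * (suc n * n * (suc n + 4)) + 3 * (2 * n + m * (n * suc n)) + 6 + 12 * suc (suc n * m) ≡
                     3 * (suc (suc n) * (suc (suc n) + 3)) + m * (suc (suc n) * suc n * (suc (suc n) + 4))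
    expand = ℕ-solve-∀

triangle-bound : ∀ m h → 1 ≤ h →
  6 * (h + sumTo (λ i → suc (suc i * m) * suc (h ∸ suc i)) (h ∸ 1)) ≤
  3 * (h * (h + 3)) + m * (h * (h ∸ 1) * (h + 4))
triangle-bound m (suc n) _ = ℕP.≤-trans (ℕP.m≤m+n _ 6) (ℕP.≤-reflexive (triangle-closed-form m n))

≡ᵇ-true⇒≡ : ∀ {m n} → (m ℕ.≡ᵇ n) ≡ true → m ≡ n
≡ᵇ-true⇒≡ {m} {n} e = ℕP.≡ᵇ⇒≡ m n (Equivalence.from T-≡ e)

≡ᵇ-refl : ∀ n → (n ℕ.≡ᵇ n) ≡ true
≡ᵇ-refl n = Equivalence.to T-≡ (ℕP.≡⇒≡ᵇ n n refl)

i≤+∣i∣ : ∀ i → i ℤ.≤ + ℤ.∣ i ∣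
i≤+∣i∣ (+ n)      = ℤP.≤-refl
i≤+∣i∣ -[1+ n ] = ℤ.-≤+

≥+⇒+ : ∀ {N z} → + N ℤ.≤ z → ∃ λ q → z ≡ + q × N ≤ q
≥+⇒+ (ℤ.+≤+ N≤q) = _ , refl , N≤q

module Removal (A : Subset) (a d : ℤ) (k h g : ℕ)
         (A-basis : IsBasisWith A h) (B-basis : IsBasisWith (A ∖ AP a d k) g) where

  private
    X B : Subset
    X = AP a d k
    B = A ∖ X

    m : ℕ
    m = k ∸ 1

    μ : ℕ
    μ = proj₁ (negatives-bounded (proj₁ A-basis))

    A≥-μ : ∀ {x} → A x → ℤ.- + μ ℤ.≤ x
    A≥-μ = proj₂ (negatives-bounded (proj₁ A-basis))

    NA NB : ℕ
    NA = proj₁ (proj₂ A-basis)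
    NB = proj₁ (proj₂ B-basis)

    A-rep : ∀ n → NA ≤ n → SumOf A h (+ n)
    A-rep = proj₂ (proj₂ A-basis)

    B-rep : ∀ n → NB ≤ n → SumOf B g (+ n)
    B-rep = proj₂ (proj₂ B-basis)

  apSum : ℕ → ℕ → ℤ
  apSum i u = + i ℤ.* a ℤ.+ + u ℤ.* d

  record Typed (n : ℕ) (z : ℤ) : Set where
    constructor typed
    field
      i u  : ℕ
      i≤n  : i ≤ n
      u≤im : u ≤ i * m
      rest : SumOf B (n ∸ i) (z ℤ.- apSum i u)

  X? : ∀ z → Dec (X z)
  X? z = ℕP.anyUpTo? (λ t → z ℤ.≟ a ℤ.+ + t ℤ.* d) k

  classify : ∀ {n z} → SumOf A n z → Typed n z
  classify ([] , [] , refl) = typed 0 0 z≤n z≤n ([] , [] , refl)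
  classify (x ∷ v , Ax ∷ Av , refl) with classify (v , Av , refl) | X? x
  ... | typed i u i≤n u≤im (β , Bβ , eq) | yes (t , t<k , refl) =
    typed (suc i) (t + u) (s≤s i≤n) (ℕP.+-mono-≤ (ℕP.<⇒≤pred t<k) u≤im)
          (β , Bβ , trans eq (move-to-X a d (+ t) (+ i) (+ u) (sumℤ v)))
    where
    move-to-X : ∀ a d T I U σ → σ ℤ.- (I ℤ.* a ℤ.+ U ℤ.* d) ≡
                a ℤ.+ T ℤ.* d ℤ.+ σ ℤ.- ((+ 1 ℤ.+ I) ℤ.* a ℤ.+ (T ℤ.+ U) ℤ.* d)
    move-to-X = solve-∀
  ... | typed i u i≤n u≤im rest | no x∉X =
    typed i u (ℕP.m≤n⇒m≤1+n i≤n) u≤im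
          (subst₂ (SumOf B) (sym (ℕP.+-∸-assoc 1 i≤n)) (sym (ℤP.+-assoc x (sumℤ v) (ℤ.- apSum i u)))
                  (SumOf-+ (SumOf-singleton (Ax , x∉X)) rest))

  private
    hX-bound : ℕ
    hX-bound = h * ℤ.∣ a ∣ + h * m * ℤ.∣ d ∣

    N-proper : ℕ
    N-proper = NA + suc hX-bound

  apSum-bound : ∀ i u → ℤ.∣ apSum i u ∣ ≤ i * ℤ.∣ a ∣ + u * ℤ.∣ d ∣
  apSum-bound i u = ℕP.≤-trans (ℤP.∣i+j∣≤∣i∣+∣j∣ (+ i ℤ.* a) (+ u ℤ.* d))
                              (ℕP.≤-reflexive (cong₂ _+_ (ℤP.abs-* (+ i) a) (ℤP.abs-* (+ u) d)))

  all-in-X⇒bounded : ∀ {z} (t : Typed h z) → Typed.i t ≡ h → ℤ.∣ z ∣ ≤ hX-bound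
  all-in-X⇒bounded {z} (typed i u _ u≤im rest) i≡h = begin
    ℤ.∣ z ∣                        ≡⟨ cong ℤ.∣_∣ z≡apSum ⟩
    ℤ.∣ apSum i u ∣                ≤⟨ apSum-bound i u ⟩
    i * ℤ.∣ a ∣ + u * ℤ.∣ d ∣      ≤⟨ ℕP.+-monoʳ-≤ (i * ℤ.∣ a ∣) (ℕP.*-monoˡ-≤ ℤ.∣ d ∣ u≤im) ⟩
    i * ℤ.∣ a ∣ + i * m * ℤ.∣ d ∣  ≡⟨ cong (λ n → n * ℤ.∣ a ∣ + n * m * ℤ.∣ d ∣) i≡h ⟩
    hX-bound                       ∎
    where
    open ℕP.≤-Reasoning
    no-rest : h ∸ i ≡ 0
    no-rest = trans (cong (h ∸_) i≡h) (ℕP.n∸n≡0 h)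
    z≡apSum : z ≡ apSum i u
    z≡apSum = ℤP.i-j≡0⇒i≡j z (apSum i u) (SumOf-zero (subst (λ n → SumOf B n (z ℤ.- apSum i u)) no-rest rest))

  large⇒proper-type : ∀ p → N-proper ≤ p → Σ (Typed h (+ p)) λ t → Typed.i t < h
  large⇒proper-type p N-proper≤p with classify (A-rep p (ℕP.m+n≤o⇒m≤o NA N-proper≤p))
  ... | t with ℕP.m≤n⇒m<n∨m≡n (Typed.i≤n t)
  ...   | inj₁ i<h = t , i<h
  ...   | inj₂ i≡h = ⊥-elim (ℕP.<⇒≱ (ℕP.m+n≤o⇒n≤o NA N-proper≤p) (all-in-X⇒bounded t i≡h))

  HandledSet : Set
  HandledSet = ℕ → ℕ → Bool

  insert : ℕ → ℕ → HandledSet → HandledSet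
  insert i u R i′ u′ = ((i′ ℕ.≡ᵇ i) ∧ (u′ ℕ.≡ᵇ u)) ∨ R i′ u′

  insert-elim : ∀ i u R i′ u′ → insert i u R i′ u′ ≡ true → (i′ ≡ i × u′ ≡ u) ⊎ R i′ u′ ≡ true
  insert-elim i u R i′ u′ e with i′ ℕ.≡ᵇ i in i′≡ᵇi | u′ ℕ.≡ᵇ u in u′≡ᵇu
  ... | true  | true  = inj₁ (≡ᵇ-true⇒≡ i′≡ᵇi , ≡ᵇ-true⇒≡ u′≡ᵇu)
  ... | true  | false = inj₂ e
  ... | false | _     = inj₂ e

  weight : ℕ → ℕ
  weight i = suc (h ∸ i)

  cost : HandledSet → ℕ → ℕ → ℕ
  cost R i u = if R i u then 0 else weight i

  cost-≤-weight : ∀ R i u → cost R i u ≤ weight i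
  cost-≤-weight R i u with R i u
  ... | true  = z≤n
  ... | false = ℕP.≤-refl

  cost-insert-≤ : ∀ R i u i′ u′ → cost (insert i u R) i′ u′ ≤ cost R i′ u′
  cost-insert-≤ R i u i′ u′ with (i′ ℕ.≡ᵇ i) ∧ (u′ ℕ.≡ᵇ u) | R i′ u′
  ... | true  | _     = z≤n
  ... | false | true  = z≤n
  ... | false | false = ℕP.≤-refl

  cost-insert-self : ∀ R i u → R i u ≡ false → cost (insert i u R) i u + weight i ≤ cost R i u
  cost-insert-self R i u unhandled
    rewrite ≡ᵇ-refl i | ≡ᵇ-refl u | unhandled = ℕP.≤-refl

  -- Row i₀ holds the types (i₀ + 1, u) with u ≤ (i₀ + 1) m.
  unhandled-weight : HandledSet → ℕ
  unhandled-weight R = sumTo (λ i₀ → sumTo (cost R (suc i₀)) (suc (suc i₀ * m))) (h ∸ 1)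

  budget : ℕ
  budget = unhandled-weight (λ _ _ → false)

  budget-≡ : budget ≡ sumTo (λ i → suc (suc i * m) * suc (h ∸ suc i)) (h ∸ 1)
  budget-≡ = sumTo-cong (λ i → sumTo-const (weight (suc i)) (suc (suc i * m))) (h ∸ 1)

  unhandled-weight-≤-budget : ∀ R → unhandled-weight R ≤ budget
  unhandled-weight-≤-budget R =
    sumTo-mono-≤ (λ i₀ → sumTo-mono-≤ (cost-≤-weight R (suc i₀)) (suc (suc i₀ * m))) (h ∸ 1)

  unhandled-weight-insert : ∀ R {i u} → 1 ≤ i → i < h → u ≤ i * m → R i u ≡ false →
                            unhandled-weight (insert i u R) + weight i ≤ unhandled-weight R
  unhandled-weight-insert R {suc i₀} {u} _ i<h u≤im unhandled =
    sumTo-gap (λ i₁ → sumTo-mono-≤ (cost-insert-≤ R (suc i₀) u (suc i₁)) (suc (suc i₁ * m)))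
              (sumTo-gap (cost-insert-≤ R (suc i₀) u (suc i₀)) (cost-insert-self R (suc i₀) u unhandled)
                         (suc (suc i₀ * m)) (s≤s u≤im))
              (h ∸ 1) (ℕP.∸-monoˡ-< i<h (s≤s z≤n))

  record Invariant (R : HandledSet) (L : ℕ) (s : ℤ) : Set where
    field
      handled   : ∀ i u → R i u ≡ true → SumOf B (L + i) (apSum i u ℤ.+ s)
      handles₀₀ : R 0 0 ≡ true
      in-budget : L + unhandled-weight R ≤ budget

  Unhandled Handled : HandledSet → Subset
  Unhandled R z = Σ (Typed h z) λ t → Typed.i t < h × R (Typed.i t) (Typed.u t) ≡ false
  Handled   R z = Σ (Typed h z) λ t → R (Typed.i t) (Typed.u t) ≡ true

  Escape : HandledSet → Set
  Escape R = Crossing B (Unhandled R) (Handled R)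

  unhandled⇒1≤i : ∀ (R : HandledSet) {i u} → R 0 0 ≡ true → R i u ≡ false → u ≤ i * m → 1 ≤ i
  unhandled⇒1≤i R {suc _}        _   _         _   = s≤s z≤n
  unhandled⇒1≤i R {zero} {zero} h₀₀ unhandled z≤n with trans (sym h₀₀) unhandled
  ... | ()

  weight-+-i : ∀ L {i} → i ≤ h → L + weight i + i ≡ suc (L + h)
  weight-+-i L {i} i≤h = begin
    L + suc (h ∸ i) + i    ≡⟨ regroup L (h ∸ i) i ⟩
    suc (L + (h ∸ i + i))  ≡⟨ cong (λ n → suc (L + n)) (ℕP.m∸n+n≡m i≤h) ⟩
    suc (L + h)            ∎
    where
    open ≡-Reasoning
    regroup : ∀ L x i → L + suc x + i ≡ suc (L + (x + i))
    regroup = ℕ-solve-∀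

  handled-through-escape : ∀ {R L s z c b i u i′ u′} → Invariant R L s → B b → i ≤ h → i′ ≤ h →
    SumOf B (h ∸ i′) (z ℤ.+ c ℤ.- b ℤ.- apSum i′ u′) → R i′ u′ ≡ true →
    SumOf B (L + weight i + i) (apSum i u ℤ.+ (s ℤ.+ (c ℤ.+ (z ℤ.- apSum i u))))
  handled-through-escape {R} {L} {s} {z} {c} {b} {i} {u} {i′} {u′} inv Bb i≤h i′≤h rest′ handled′ =
    subst₂ (SumOf B) length (regroup z c b (apSum i u) (apSum i′ u′) s)
           (SumOf-+ rest′ (SumOf-+ (SumOf-singleton Bb) (Invariant.handled inv i′ u′ handled′)))
    where
    regroup : ∀ z c b p p′ s → z ℤ.+ c ℤ.- b ℤ.- p′ ℤ.+ (b ℤ.+ (p′ ℤ.+ s)) ≡ p ℤ.+ (s ℤ.+ (c ℤ.+ (z ℤ.- p)))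
    regroup = solve-∀
    reorder : ∀ L x i → x + (1 + (L + i)) ≡ L + suc x + i
    reorder = ℕ-solve-∀
    length : h ∸ i′ + (1 + (L + i′)) ≡ L + weight i + i
    length = trans (reorder L (h ∸ i′) i′) (trans (weight-+-i L i′≤h) (sym (weight-+-i L i≤h)))

  handled-after-shift : ∀ {R L s z c i u i₂ u₂} → Invariant R L s → B c →
    SumOf B (h ∸ i) (z ℤ.- apSum i u) → R i₂ u₂ ≡ true →
    SumOf B (L + weight i + i₂) (apSum i₂ u₂ ℤ.+ (s ℤ.+ (c ℤ.+ (z ℤ.- apSum i u))))
  handled-after-shift {R} {L} {s} {z} {c} {i} {u} {i₂} {u₂} inv Bc rest handled₂ =
    subst₂ (SumOf B) (reorder L (h ∸ i) i₂) (ℤP.+-assoc (apSum i₂ u₂) s (c ℤ.+ (z ℤ.- apSum i u)))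
           (SumOf-+ (Invariant.handled inv i₂ u₂ handled₂) (SumOf-+ (SumOf-singleton Bc) rest))
    where
    reorder : ∀ L x i → L + i + (1 + x) ≡ L + suc x + i
    reorder = ℕ-solve-∀

  absorb-escape : ∀ {R L s} → Invariant R L s → Escape R →
    ∃ λ R′ → ∃ λ L′ → ∃ λ s′ → Invariant R′ L′ s′ × unhandled-weight R′ < unhandled-weight R
  absorb-escape {R} {L} {s} inv
    (z , c , b , Bc , Bb , (typed i u i≤h u≤im rest , i<h , unhandled) , (typed i′ u′ i′≤h _ rest′ , handled′)) =
    insert i u R , L + weight i , s ℤ.+ (c ℤ.+ (z ℤ.- apSum i u)) ,
    record { handled = handled-insert ; handles₀₀ = handles₀₀-insert ; in-budget = in-budget-insert } ,
    ℕP.<-≤-trans (ℕP.m<m+n _ (s≤s z≤n)) weight-drop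
    where
    open Invariant inv
    weight-drop : unhandled-weight (insert i u R) + weight i ≤ unhandled-weight R
    weight-drop = unhandled-weight-insert R (unhandled⇒1≤i R handles₀₀ unhandled u≤im) i<h u≤im unhandled

    handled-insert : ∀ i₂ u₂ → insert i u R i₂ u₂ ≡ true →
                     SumOf B (L + weight i + i₂) (apSum i₂ u₂ ℤ.+ (s ℤ.+ (c ℤ.+ (z ℤ.- apSum i u))))
    handled-insert i₂ u₂ e with insert-elim i u R i₂ u₂ e
    ... | inj₁ (refl , refl) = handled-through-escape {z = z} {c} {u = u} inv Bb i≤h i′≤h rest′ handled′
    ... | inj₂ old           = handled-after-shift {z = z} {c} {i} {u} {i₂} {u₂} inv Bc rest old

    handles₀₀-insert : insert i u R 0 0 ≡ true
    handles₀₀-insert = trans (cong (_ ∨_) handles₀₀) (∨-zeroʳ _)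

    in-budget-insert : L + weight i + unhandled-weight (insert i u R) ≤ budget
    in-budget-insert = begin
      L + weight i + unhandled-weight (insert i u R)    ≡⟨ regroup L (weight i) _ ⟩
      L + (unhandled-weight (insert i u R) + weight i)  ≤⟨ ℕP.+-monoʳ-≤ L weight-drop ⟩
      L + unhandled-weight R                            ≤⟨ in-budget ⟩
      budget                                            ∎
      where
      open ℕP.≤-Reasoning
      regroup : ∀ L w v → L + w + v ≡ L + (v + w)
      regroup = ℕ-solve-∀

  Saturated : Set
  Saturated = ∃ λ R → ∃ λ L → ∃ λ s → Invariant R L s × ¬ Escape R

  saturate : ∀ {R L s} → Invariant R L s → Acc _<_ (unhandled-weight R) → ¬ ¬ Saturated
  saturate {R} {L} {s} inv (acc lighter-acc) unsaturated = ¬¬-excluded-middle λ where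
    (yes escape)   → let (_ , _ , _ , inv′ , lighter) = absorb-escape inv escape
                     in saturate inv′ (lighter-acc lighter) unsaturated
    (no no-escape) → unsaturated (R , L , s , inv , no-escape)

  invariant₀ : Invariant (insert 0 0 (λ _ _ → false)) 0 (+ 0)
  invariant₀ = record
    { handled = handled₀ ; handles₀₀ = refl ; in-budget = unhandled-weight-≤-budget (insert 0 0 (λ _ _ → false)) }
    where
    handled₀ : ∀ i u → insert 0 0 (λ _ _ → false) i u ≡ true → SumOf B i (apSum i u ℤ.+ + 0)
    handled₀ i u e with insert-elim 0 0 (λ _ _ → false) i u e
    ... | inj₁ (refl , refl) = [] , [] , refl

  unhandled⊎handled : ∀ R z → + N-proper ℤ.≤ z → Unhandled R z ⊎ Handled R z
  unhandled⊎handled R z N-proper≤z with ≥+⇒+ N-proper≤z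
  ... | p , refl , N-proper≤p with large⇒proper-type p N-proper≤p
  ...   | t , i<h with R (Typed.i t) (Typed.u t) in eq
  ...     | true  = inj₂ (t , eq)
  ...     | false = inj₁ (t , i<h , eq)

  private
    N-walk : ℕ
    N-walk = N-proper + g * μ + NB

  record Detour (p : ℕ) : Set where
    field
      C D     : Vec ℤ g
      BC      : All B C
      BD      : All B D
      D-bound : + N-proper ℤ.- + g ℤ.* (ℤ.- + μ) ℤ.≤ + p ℤ.- sumℤ D
      end     : SumOf B h (+ p ℤ.+ sumℤ C ℤ.- sumℤ D)

  -- The walk ends at y = h x for some x ∈ B above p; C and D represent y − p + NB and NB.
  detour : ∀ p → N-walk ≤ p → Detour p
  detour p N-walk≤p = record
    { C = proj₁ C-rep ; D = proj₁ D-rep ; BC = proj₁ (proj₂ C-rep) ; BD = proj₁ (proj₂ D-rep)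
    ; D-bound = D-bound ; end = subst (SumOf B h) arrival y-rep
    }
    where
    open ℤP.≤-Reasoning
    D-rep : SumOf B g (+ NB)
    D-rep = B-rep NB ℕP.≤-refl

    large : ∃ λ x → B x × + p ℤ.< x
    large = IsBasisWith⇒unbounded B-basis p
    x : ℤ
    x = proj₁ large
    p<x : + p ℤ.< x
    p<x = proj₂ (proj₂ large)
    y : ℤ
    y = sumℤ (replicate h x)

    y-rep : SumOf B h y
    y-rep = replicate h x , All-replicate h (proj₁ (proj₂ large)) , refl
    p≤y : + p ℤ.≤ y
    p≤y = ℤP.≤-trans (ℤP.<⇒≤ p<x)
      (sumℤ-replicate-≥ h (IsBasisWith⇒1≤ A-basis) (ℤP.≤-trans (ℤ.+≤+ z≤n) (ℤP.<⇒≤ p<x)))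

    C-target : ∃ λ q → y ℤ.- + p ℤ.+ + NB ≡ + q × NB ≤ q
    C-target = ≥+⇒+ {NB} {y ℤ.- + p ℤ.+ + NB}
      (ℤP.≤-trans (ℤP.≤-reflexive (sym (ℤP.+-identityˡ (+ NB)))) (ℤP.+-monoˡ-≤ (+ NB) (ℤP.i≤j⇒0≤j-i p≤y)))
    C-rep : SumOf B g (y ℤ.- + p ℤ.+ + NB)
    C-rep = subst (SumOf B g) (sym (proj₁ (proj₂ C-target))) (B-rep _ (proj₂ (proj₂ C-target)))

    D-bound : + N-proper ℤ.- + g ℤ.* (ℤ.- + μ) ℤ.≤ + p ℤ.- sumℤ (proj₁ D-rep)
    D-bound = begin
      + N-proper ℤ.- + g ℤ.* (ℤ.- + μ)
        ≡⟨ unfold (+ N-proper) (+ g) (+ μ) (+ NB) ⟩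
      + N-proper ℤ.+ + g ℤ.* + μ ℤ.+ + NB ℤ.- + NB
        ≡⟨ cong (λ w → + N-proper ℤ.+ w ℤ.+ + NB ℤ.- + NB) (ℤP.pos-* g μ) ⟨
      + N-walk ℤ.- + NB
        ≤⟨ ℤP.+-monoˡ-≤ (ℤ.- + NB) (ℤ.+≤+ N-walk≤p) ⟩
      + p ℤ.- + NB
        ≡⟨ cong (λ w → + p ℤ.- w) (proj₂ (proj₂ D-rep)) ⟨
      + p ℤ.- sumℤ (proj₁ D-rep)
        ∎
      where
      unfold : ∀ N G M b → N ℤ.- G ℤ.* (ℤ.- M) ≡ N ℤ.+ G ℤ.* M ℤ.+ b ℤ.- b
      unfold = solve-∀

    arrival : y ≡ + p ℤ.+ sumℤ (proj₁ C-rep) ℤ.- sumℤ (proj₁ D-rep)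
    arrival = trans (telescope y (+ p) (+ NB))
      (sym (cong₂ (λ σ τ → + p ℤ.+ σ ℤ.- τ) (proj₂ (proj₂ C-rep)) (proj₂ (proj₂ D-rep))))
      where
      telescope : ∀ y p b → y ≡ p ℤ.+ (y ℤ.- p ℤ.+ b) ℤ.- b
      telescope = solve-∀

  escape-free⇒handled : ∀ {R} → R 0 0 ≡ true → ¬ Escape R → ∀ p → N-walk ≤ p → Handled R (+ p)
  escape-free⇒handled {R} handles₀₀ no-escape p N-walk≤p =
    [ (λ unhandled → ⊥-elim (no-escape
        (walk-crosses (ℤ.- + μ) (λ Bx → A≥-μ (proj₁ Bx)) (+ N-proper) (unhandled⊎handled R) (IsBasisWith⇒1≤ B-basis)
                      C D BC BD (+ p) D-bound unhandled (end-typed , handles₀₀))))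
    , id
    ]′ (unhandled⊎handled R (+ p) (ℤ.+≤+ (ℕP.m+n≤o⇒m≤o N-proper (ℕP.m+n≤o⇒m≤o (N-proper + g * μ) N-walk≤p))))
    where
    open Detour (detour p N-walk≤p)
    end-typed : Typed h (+ p ℤ.+ sumℤ C ℤ.- sumℤ D)
    end-typed = typed 0 0 z≤n z≤n (subst (SumOf B h) (sym (ℤP.+-identityʳ _)) end)

  saturated⇒basis : ∀ {R L s} → Invariant R L s → ¬ Escape R → IsBasisWith B (h + L)
  saturated⇒basis {R} {L} {s} inv no-escape = B-negatives , N-walk + ℤ.∣ s ∣ , represent
    where
    open Invariant inv
    B-negatives : FinitelyManyNegatives B
    B-negatives = proj₁ (proj₁ A-basis) , λ x Bx → proj₂ (proj₁ A-basis) x (proj₁ Bx)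

    shifted : ∀ n → N-walk + ℤ.∣ s ∣ ≤ n → + N-walk ℤ.≤ + n ℤ.- s
    shifted n le = begin
      + N-walk                            ≡⟨ cancel (+ N-walk) (+ ℤ.∣ s ∣) ⟩
      + (N-walk + ℤ.∣ s ∣) ℤ.- + ℤ.∣ s ∣  ≤⟨ ℤP.+-mono-≤ (ℤ.+≤+ le) (ℤP.neg-mono-≤ (i≤+∣i∣ s)) ⟩
      + n ℤ.- s                           ∎
      where
      open ℤP.≤-Reasoning
      cancel : ∀ x y → x ≡ x ℤ.+ y ℤ.- y
      cancel = solve-∀

    represent : ∀ n → N-walk + ℤ.∣ s ∣ ≤ n → SumOf B (h + L) (+ n)
    represent n le with ≥+⇒+ (shifted n le)
    ... | p , n-s≡p , N-walk≤p with escape-free⇒handled handles₀₀ no-escape p N-walk≤p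
    ...   | typed i u i≤h _ rest , handled-iu =
      subst₂ (SumOf B) length value (SumOf-+ rest (handled i u handled-iu))
      where
      regroup : ∀ x L i → x + (L + i) ≡ x + i + L
      regroup = ℕ-solve-∀
      length : h ∸ i + (L + i) ≡ h + L
      length = trans (regroup (h ∸ i) L i) (cong (_+ L) (ℕP.m∸n+n≡m i≤h))

      recombine : ∀ p q s → p ℤ.- q ℤ.+ (q ℤ.+ s) ≡ p ℤ.+ s
      recombine = solve-∀
      cancel : ∀ n s → n ℤ.- s ℤ.+ s ≡ n
      cancel = solve-∀
      value : + p ℤ.- apSum i u ℤ.+ (apSum i u ℤ.+ s) ≡ + n
      value = begin
        + p ℤ.- apSum i u ℤ.+ (apSum i u ℤ.+ s)  ≡⟨ recombine (+ p) (apSum i u) s ⟩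
        + p ℤ.+ s                                ≡⟨ cong (ℤ._+ s) n-s≡p ⟨
        + n ℤ.- s ℤ.+ s                          ≡⟨ cancel (+ n) s ⟩
        + n                                      ∎
        where open ≡-Reasoning

  basis-within-budget : ¬ ¬ (∃ λ L → L ≤ budget × IsBasisWith B (h + L))
  basis-within-budget =
    ¬¬-map (λ (_ , L , _ , inv , no-escape) →
              L , ℕP.m+n≤o⇒m≤o L (Invariant.in-budget inv) , saturated⇒basis inv no-escape)
           (saturate invariant₀ (<-wellFounded _))

  order-≤-h+budget : ∀ g′ → (∀ n → IsBasisWith B n → g′ ≤ n) → g′ ≤ h + budget
  order-≤-h+budget g′ g′-minimal = decidable-stable (g′ ℕP.≤? h + budget) (¬¬-map within basis-within-budget)
    where
    within : (∃ λ L → L ≤ budget × IsBasisWith B (h + L)) → g′ ≤ h + budget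
    within (L , L≤budget , basis) = ℕP.≤-trans (g′-minimal (h + L) basis) (ℕP.+-monoʳ-≤ h L≤budget)

corollary2 : (A : Subset) (a d : ℤ) (k : ℕ) →
    -- X = {a, a+d, ..., a+(k-1)d} with d > 0, so X is nonempty with |X| = k
    0 < k → + 0 ℤ.< d →
    (∀ z → AP a d k z → A z) →
    ∀ h g → IsOrder A h → IsOrder (A ∖ AP a d k) g →
    6 * g ≤ 3 * (h * (h + 3)) + (k ∸ 1) * (h * (h ∸ 1) * (h + 4))
corollary2 A a d k _ _ _ h g (A-basis , _) (B-basis , g-minimal) = begin
  6 * g             ≤⟨ ℕP.*-monoʳ-≤ 6 (order-≤-h+budget g g-minimal) ⟩
  6 * (h + budget)  ≡⟨ cong (λ b → 6 * (h + b)) budget-≡ ⟩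
  6 * (h + sumTo (λ i → suc (suc i * (k ∸ 1)) * suc (h ∸ suc i)) (h ∸ 1))
                    ≤⟨ triangle-bound (k ∸ 1) h (IsBasisWith⇒1≤ A-basis) ⟩
  3 * (h * (h + 3)) + (k ∸ 1) * (h * (h ∸ 1) * (h + 4)) ∎
  where
  open Removal A a d k h g A-basis B-basis
  open ℕP.≤-Reasoning
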